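{- Let $G=(V,E)$ be a graph, $T$ any $4$-Steiner root of $G$, $K_i$ a maximal clique of $G$, and $X\subsetneq K_i$ a clique-intersection of $G$. If $T\langle X\rangle$ is a bistar, then $\mathcal{C}(T\langle K_i\rangle)\subsetneq\mathcal{C}(T\langle X\rangle)$. In particular, there are exactly two maximal cliques of $G$ that contain $X$.
   Context: A $4$-Steiner root of $G$ is a tree $T$ with $V\subseteq V(T)$ such that for distinct $u,v\in V$, $uv\in E$ iff $\mathrm{dist}_T(u,v)\le 4$. $T\langle X\rangle$ is the smallest subtree of $T$ containing $X$, $\mathcal{C}(T')$ the center of a tree $T'$. A bistar is a tree of diameter exactly $3$. A clique-intersection is a nonempty intersection of one or more maximal cliques of $G$. -}

module Defs where

open import Data.Nat using (ℕ; zero; suc; _≤_)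
open import Data.Fin using (Fin; zero; suc; inject₁; fromℕ)
open import Data.Fin.Subset using (Subset; _∈_; _⊆_; _⊂_; Nonempty)
open import Data.Product using (Σ; ∃; _×_; _,_)
open import Data.Empty using (⊥)
open import Data.Unit using (⊤)
open import Relation.Nullary using (¬_)
open import Relation.Binary.PropositionalEquality using (_≡_; _≢_)
open import Function.Definitions using (Injective)
open import Function.Bundles using (_⇔_)

record Graph (n : ℕ) : Set₁ where
  field
    Adj     : Fin n → Fin n → Set
    sym     : ∀ {u v} → Adj u v → Adj v u
    irrefl  : ∀ {u} → ¬ Adj u u
open Graph public

-- Walks of length k from u to v all of whose vertices lie in the
-- vertex set P (a predicate); P = everything gives ordinary walks.
data Walk {n : ℕ} (G : Graph n) (P : Fin n → Set) : Fin n → Fin n → ℕ → Set where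
  here : ∀ {u} → P u → Walk G P u u zero
  step : ∀ {u w v k} → P u → Adj G u w → Walk G P w v k → Walk G P u v (suc k)

-- dist_{G[P]}(u,v) ≤ k  (distance in the subgraph induced by P)
DistLe : {n : ℕ} → Graph n → (Fin n → Set) → Fin n → Fin n → ℕ → Set
DistLe G P u v k = ∃ λ j → j ≤ k × Walk G P u v j

All : {n : ℕ} → Fin n → Set
All _ = ⊤

InS : {n : ℕ} → Subset n → Fin n → Set
InS S v = v ∈ S

Connected : {n : ℕ} → Graph n → Set
Connected G = ∀ u v → ∃ λ k → Walk G All u v k

-- a cycle: c = k+3 pairwise distinct vertices, consecutive ones adjacent,
-- and the last adjacent to the first
HasCycle : {n : ℕ} → Graph n → Set
HasCycle G = ∃ λ k → Σ (Fin (suc (suc (suc k))) → Fin _) λ f →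
  Injective _≡_ _≡_ f
  × (∀ (i : Fin (suc (suc k))) → Adj G (f (inject₁ i)) (f (suc i)))
  × Adj G (f (fromℕ (suc (suc k)))) (f zero)

record Tree (m : ℕ) : Set₁ where
  field
    graph     : Graph m
    connected : Connected graph
    acyclic   : ¬ HasCycle graph
open Tree public

-- 4-Steiner roots: a tree T on Fin m together with an injection
-- ι : V(G) → V(T) (so V ⊆ V(T)) such that for distinct u v,
-- uv ∈ E  iff  dist_T(ι u, ι v) ≤ 4.

record SteinerRoot4 {n : ℕ} (G : Graph n) : Set₁ where
  field
    m     : ℕ
    T     : Tree m
    ι     : Fin n → Fin m
    ι-inj : Injective _≡_ _≡_ ι
    root  : ∀ u v → u ≢ v → Adj G u v ⇔ DistLe (graph T) All (ι u) (ι v) 4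
open SteinerRoot4 public

IsClique : {n : ℕ} → Graph n → Subset n → Set
IsClique G K = ∀ u v → u ∈ K → v ∈ K → u ≢ v → Adj G u v

IsMaximalClique : {n : ℕ} → Graph n → Subset n → Set
IsMaximalClique G K = IsClique G K × (∀ K' → IsClique G K' → K ⊆ K' → K' ⊆ K)

-- nonempty intersection of one or more (k+1) maximal cliques
IsCliqueIntersection : {n : ℕ} → Graph n → Subset n → Set
IsCliqueIntersection G X =
  Nonempty X ×
  (∃ λ k → Σ (Fin (suc k) → Subset _) λ Ks →
     (∀ j → IsMaximalClique G (Ks j)) × (∀ v → (v ∈ X) ⇔ (∀ j → v ∈ Ks j)))

-- Subtrees of a tree T (vertex sets inducing connected subgraphs)

ConnectedIn : {m : ℕ} → Tree m → Subset m → Set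
ConnectedIn T S = ∀ a b → a ∈ S → b ∈ S → ∃ λ k → Walk (graph T) (InS S) a b k

-- S = T⟨X⟩ for X ⊆ V(G) (viewed in T via ι): the smallest subtree of T
-- containing ι[X].
IsSpanningSubtree : {n : ℕ} {G : Graph n} (R : SteinerRoot4 G) → Subset n → Subset (m R) → Set
IsSpanningSubtree R X S =
  ConnectedIn (T R) S
  × (∀ x → x ∈ X → ι R x ∈ S)
  × (∀ S' → ConnectedIn (T R) S' → (∀ x → x ∈ X → ι R x ∈ S') → S ⊆ S')

EccLe : {m : ℕ} → Tree m → Subset m → Fin m → ℕ → Set
EccLe T S v e = ∀ w → w ∈ S → DistLe (graph T) (InS S) v w e

-- v ∈ 𝒞(S): v ∈ S and ecc(v) ≤ ecc(u) for all u ∈ S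
InCenter : {m : ℕ} → Tree m → Subset m → Fin m → Set
InCenter T S v = v ∈ S × (∀ u → u ∈ S → ∀ e → EccLe T S u e → EccLe T S v e)

-- the subtree S is a bistar: diameter exactly 3
IsBistar : {m : ℕ} → Tree m → Subset m → Set
IsBistar T S =
  (∀ a b → a ∈ S → b ∈ S → DistLe (graph T) (InS S) a b 3)
  × (∃ λ a → ∃ λ b → a ∈ S × b ∈ S × ¬ DistLe (graph T) (InS S) a b 2)

-- Take a diametral path a₀ – a – b – b₀ of the bistar T⟨X⟩.  Its ends
-- are leaves, hence images of vertices of X, so every member of a clique
-- K ⊇ X is within tree distance 4 of a₀ and of b₀, and therefore within 2
-- of a or of b.  Vertices within 2 of both a and b lie in X.  A maximal
-- clique K ⊇ X has a member outside X; that member is far from a or from b,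
-- which forces all of K into the radius-2 ball around the other middle
-- vertex, and then K is exactly the set of vertices mapped into that ball.
-- So the only candidates are the two balls, giving "exactly two".  For the
-- centres, T⟨Ki⟩ lies in the ball of radius 2 about (say) a and reaches
-- distance 3 from b, which makes a its unique centre, while a and b are
-- both centres of the bistar.
module Submission where

open import Defs hiding (sym)
open import Data.Bool using (true)
open import Data.Nat using (ℕ; zero; suc; _+_; _≤_; _<_; _≤?_; z≤n; s≤s)
open import Data.Nat.Properties hiding (_≟_)
open import Data.Fin using (Fin; zero; suc; inject₁; fromℕ; _≟_)
open import Data.Fin.Subset using (Subset; _∈_; _∉_; _⊆_; _⊂_)
open import Data.Fin.Subset.Properties using (_∈?_; ⊆-antisym)
open import Data.Fin.Properties using (any?; all?; ¬∀⟶∃¬)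
open import Data.Vec using (tabulate)
open import Data.Vec.Properties using (lookup∘tabulate; []=⇒lookup; lookup⇒[]=)
open import Data.Product using (Σ; ∃; _×_; _,_; proj₁; proj₂)
open import Data.Sum using (_⊎_; inj₁; inj₂)
open import Data.Empty using (⊥; ⊥-elim)
open import Data.Unit using (⊤; tt)
open import Relation.Nullary using (¬_; Dec; yes; no; does)
open import Relation.Nullary.Decidable using (dec-true; _×-dec_; _⊎-dec_; ¬?)
open import Relation.Binary.PropositionalEquality using (_≡_; _≢_; refl; sym; trans; cong; subst)
open import Function using (id; _∘_; case_of_)
open import Function.Bundles using (Equivalence)

subsetOf : ∀ {k} {P : Fin k → Set} → (∀ i → Dec (P i)) → Subset k
subsetOf P? = tabulate (λ i → does (P? i))

∈-subsetOf⁺ : ∀ {k} {P : Fin k → Set} (P? : ∀ i → Dec (P i)) {i} → P i → i ∈ subsetOf P?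
∈-subsetOf⁺ P? {i} p = lookup⇒[]= i _ (trans (lookup∘tabulate _ i) (dec-true (P? i) p))

∈-subsetOf⁻ : ∀ {k} {P : Fin k → Set} (P? : ∀ i → Dec (P i)) {i} → i ∈ subsetOf P? → P i
∈-subsetOf⁻ P? {i} h = witness (P? i) (trans (sym (lookup∘tabulate _ i)) ([]=⇒lookup h))
  where
  witness : ∀ {A : Set} (a? : Dec A) → does a? ≡ true → A
  witness (yes a) _ = a
  witness (no _) ()

module Walks {m : ℕ} (G : Graph m) where

  _∈w_ : ∀ {P u v k} → Fin m → Walk G P u v k → Set
  x ∈w here {u} _ = x ≡ u
  x ∈w step {u} _ _ r = x ≡ u ⊎ x ∈w r

  _∈w?_ : ∀ {P u v k} (x : Fin m) (r : Walk G P u v k) → Dec (x ∈w r)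
  x ∈w? here {u} _ = x ≟ u
  x ∈w? step {u} _ _ r with x ≟ u | x ∈w? r
  ... | yes e | _ = yes (inj₁ e)
  ... | no _ | yes h = yes (inj₂ h)
  ... | no x≢u | no x∉r = no λ { (inj₁ e) → x≢u e ; (inj₂ h) → x∉r h }

  Simple : ∀ {P u v k} → Walk G P u v k → Set
  Simple (here _) = ⊤
  Simple (step {u} _ _ r) = ¬ (u ∈w r) × Simple r

  ∈w⇒P : ∀ {P u v k x} (r : Walk G P u v k) → x ∈w r → P x
  ∈w⇒P (here p) refl = p
  ∈w⇒P (step p _ r) (inj₁ refl) = p
  ∈w⇒P (step p _ r) (inj₂ h) = ∈w⇒P r h

  start∈ : ∀ {P u v k} (r : Walk G P u v k) → u ∈w r
  start∈ (here _) = refl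
  start∈ (step _ _ _) = inj₁ refl

  end∈ : ∀ {P u v k} (r : Walk G P u v k) → v ∈w r
  end∈ (here _) = refl
  end∈ (step _ _ r) = inj₂ (end∈ r)

  startP : ∀ {P u v k} (r : Walk G P u v k) → P u
  startP r = ∈w⇒P r (start∈ r)

  length-zero : ∀ {P u v} → Walk G P u v 0 → u ≡ v
  length-zero (here _) = refl

  restrict : ∀ {P Q u v k} (r : Walk G Q u v k) → (∀ y → y ∈w r → P y) → Walk G P u v k
  restrict (here {u} _) f = here (f u refl)
  restrict (step {u} _ a r) f = step (f u (inj₁ refl)) a (restrict r (λ y h → f y (inj₂ h)))

  _++w_ : ∀ {P u w v j k} → Walk G P u w j → Walk G P w v k → Walk G P u v (j + k)
  here _ ++w q = q
  step p a r ++w q = step p a (r ++w q)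

  reverse : ∀ {P u v k} → Walk G P u v k → Walk G P v u k
  reverse (here p) = here p
  reverse {P} {u} {v} (step {k = k} p a r) =
    subst (Walk G P v u) (+-comm k 1) (reverse r ++w step (startP r) (Graph.sym G a) (here p))

  Suffix : ∀ {P w v j} → Fin m → Walk G P w v j → Set
  Suffix {P} {w} {v} {j} x r = Σ ℕ λ j' → j' ≤ j × (j' ≡ j → x ≡ w) ×
     Σ (Walk G P x v j') λ r' → (Simple r → Simple r') × (∀ y → y ∈w r' → y ∈w r)

  suffix : ∀ {P w v j x} (r : Walk G P w v j) → x ∈w r → Suffix x r
  suffix (here p) refl = 0 , z≤n , (λ _ → refl) , here p , id , (λ y h → h)
  suffix {j = j} (step p a r) (inj₁ refl) = j , ≤-refl , (λ _ → refl) , step p a r , id , (λ y h → h)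
  suffix {j = suc j} (step p a r) (inj₂ h) with suffix r h
  ... | j' , le , _ , r' , simple , sub =
    j' , m≤n⇒m≤1+n le , (λ e → ⊥-elim (<-irrefl e (s≤s le))) , r' ,
    (λ s → simple (proj₂ s)) , (λ y h' → inj₂ (sub y h'))

  shortcut : ∀ {P u v k} (r : Walk G P u v k) → Σ ℕ λ j → j ≤ k × Σ (Walk G P u v j) Simple
  shortcut (here p) = 0 , z≤n , here p , tt
  shortcut (step {u} p a r) with shortcut r
  ... | j , le , r' , s with u ∈w? r'
  ...   | no u∉ = suc j , s≤s le , step p a r' , u∉ , s
  ...   | yes u∈ with suffix r' u∈
  ...     | j' , le' , _ , r'' , simple , _ = j' , ≤-trans le' (≤-trans le (n≤1+n _)) , r'' , simple s

  vertexAt : ∀ {P u v k} → Walk G P u v k → Fin (suc k) → Fin m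
  vertexAt (here {u} _) zero = u
  vertexAt (step {u} _ _ r) zero = u
  vertexAt (step _ _ r) (suc i) = vertexAt r i

  vertexAt-first : ∀ {P u v k} (r : Walk G P u v k) → vertexAt r zero ≡ u
  vertexAt-first (here _) = refl
  vertexAt-first (step _ _ _) = refl

  vertexAt-last : ∀ {P u v k} (r : Walk G P u v k) → vertexAt r (fromℕ k) ≡ v
  vertexAt-last (here _) = refl
  vertexAt-last (step _ _ r) = vertexAt-last r

  vertexAt-∈ : ∀ {P u v k} (r : Walk G P u v k) i → vertexAt r i ∈w r
  vertexAt-∈ (here _) zero = refl
  vertexAt-∈ (step _ _ r) zero = inj₁ refl
  vertexAt-∈ (step _ _ r) (suc i) = inj₂ (vertexAt-∈ r i)

  vertexAt-injective : ∀ {P u v k} (r : Walk G P u v k) → Simple r →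
                       ∀ {i i'} → vertexAt r i ≡ vertexAt r i' → i ≡ i'
  vertexAt-injective (here _) _ {zero} {zero} e = refl
  vertexAt-injective (step _ _ r) s {zero} {zero} e = refl
  vertexAt-injective (step _ _ r) s {zero} {suc i'} e =
    ⊥-elim (proj₁ s (subst (_∈w r) (sym e) (vertexAt-∈ r i')))
  vertexAt-injective (step _ _ r) s {suc i} {zero} e =
    ⊥-elim (proj₁ s (subst (_∈w r) e (vertexAt-∈ r i)))
  vertexAt-injective (step _ _ r) s {suc i} {suc i'} e = cong suc (vertexAt-injective r (proj₂ s) e)

  vertexAt-adjacent : ∀ {P u v k} (r : Walk G P u v k) (i : Fin k) →
                      Adj G (vertexAt r (inject₁ i)) (vertexAt r (suc i))
  vertexAt-adjacent (step _ a r) zero = subst (Adj G _) (sym (vertexAt-first r)) a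
  vertexAt-adjacent (step _ _ r) (suc i) = vertexAt-adjacent r i

  -- In an acyclic graph, a path a – c – b with a ≠ b cannot be bypassed:
  -- every walk from a to b passes through c (else a shortest bypass closes a cycle).
  no-bypass : ¬ HasCycle G → ∀ {a c b k} → Adj G a c → Adj G c b → a ≢ b →
              ¬ Walk G (λ w → w ≢ c) a b k
  no-bypass acyclic {a} {c} {b} ac cb a≢b r with shortcut r
  ... | zero , _ , r' , _ = a≢b (length-zero r')
  ... | suc k' , _ , r' , s = acyclic (k' , cycle , cycle-injective , cycle-adjacent , cycle-closes)
    where
    cycle : Fin (suc (suc (suc k'))) → Fin m
    cycle zero = c
    cycle (suc i) = vertexAt r' i
    cycle-injective : ∀ {x y} → cycle x ≡ cycle y → x ≡ y
    cycle-injective {zero} {zero} e = refl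
    cycle-injective {zero} {suc y} e = ⊥-elim (∈w⇒P r' (vertexAt-∈ r' y) (sym e))
    cycle-injective {suc x} {zero} e = ⊥-elim (∈w⇒P r' (vertexAt-∈ r' x) e)
    cycle-injective {suc x} {suc y} e = cong suc (vertexAt-injective r' s e)
    cycle-adjacent : ∀ (i : Fin (suc (suc k'))) → Adj G (cycle (inject₁ i)) (cycle (suc i))
    cycle-adjacent zero = subst (Adj G c) (sym (vertexAt-first r')) (Graph.sym G ac)
    cycle-adjacent (suc i) = vertexAt-adjacent r' i
    cycle-closes : Adj G (cycle (fromℕ (suc (suc k')))) (cycle zero)
    cycle-closes = subst (λ z → Adj G z c) (sym (vertexAt-last r')) (Graph.sym G cb)

-- Along a walk in a tree, the distances to a fixed
-- vertex w change by exactly one at each step (OneApart) and have no strict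
-- interior local maximum (NoPeak).
OneApart : ℕ → ℕ → Set
OneApart x y = y ≡ suc x ⊎ x ≡ suc y

NoPeak : ℕ → ℕ → ℕ → Set
NoPeak x y z = y ≡ suc x → y ≡ suc z → ⊥

rises-before-descent : ∀ {x y z} → OneApart x y → y ≡ suc z → NoPeak x y z → x ≡ suc y
rises-before-descent (inj₁ e) e₂ no-peak = ⊥-elim (no-peak e e₂)
rises-before-descent (inj₂ e) e₂ no-peak = e

valley-within-4 : ∀ {g₀ g₁ g₂ g₃} → OneApart g₀ g₁ → OneApart g₁ g₂ → OneApart g₂ g₃ →
                  NoPeak g₀ g₁ g₂ → NoPeak g₁ g₂ g₃ → g₀ ≤ 4 → g₃ ≤ 4 → g₁ ≤ 2 ⊎ g₂ ≤ 2
valley-within-4 (inj₁ refl) (inj₁ refl) (inj₁ refl) _ _ _ (s≤s (s≤s (s≤s h))) = inj₁ (s≤s h)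
valley-within-4 (inj₁ refl) (inj₁ refl) (inj₂ refl) _ p₂ _ _ = ⊥-elim (p₂ refl refl)
valley-within-4 (inj₁ refl) (inj₂ refl) _ p₁ _ _ _ = ⊥-elim (p₁ refl refl)
valley-within-4 (inj₂ refl) (inj₁ refl) (inj₁ refl) _ _ _ (s≤s (s≤s h)) = inj₁ h
valley-within-4 (inj₂ refl) (inj₁ refl) (inj₂ refl) _ p₂ _ _ = ⊥-elim (p₂ refl refl)
valley-within-4 (inj₂ refl) (inj₂ refl) (inj₁ refl) _ _ (s≤s (s≤s h)) _ = inj₂ h
valley-within-4 (inj₂ refl) (inj₂ refl) (inj₂ refl) _ _ (s≤s (s≤s (s≤s h))) _ = inj₂ (s≤s h)

valley-within-3 : ∀ {g₀ g₁ g₂ g₃} → OneApart g₀ g₁ → OneApart g₁ g₂ → OneApart g₂ g₃ →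
                  NoPeak g₀ g₁ g₂ → NoPeak g₁ g₂ g₃ → g₀ ≤ 3 → g₃ ≤ 3 → g₁ ≤ 2
valley-within-3 (inj₁ refl) (inj₁ refl) (inj₁ refl) _ _ _ (s≤s (s≤s (s≤s h))) = s≤s (m≤n⇒m≤1+n h)
valley-within-3 (inj₁ refl) (inj₁ refl) (inj₂ refl) _ p₂ _ _ = ⊥-elim (p₂ refl refl)
valley-within-3 (inj₁ refl) (inj₂ refl) _ p₁ _ _ _ = ⊥-elim (p₁ refl refl)
valley-within-3 (inj₂ refl) _ _ _ _ (s≤s h) _ = h

valley-within-2 : ∀ {g₀ g₁ g₂ g₃ g₄} →
                  OneApart g₀ g₁ → OneApart g₁ g₂ → OneApart g₂ g₃ → OneApart g₃ g₄ →
                  NoPeak g₀ g₁ g₂ → NoPeak g₁ g₂ g₃ → NoPeak g₂ g₃ g₄ → g₀ ≤ 2 → g₄ ≤ 2 → g₂ ≡ 0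
valley-within-2 (inj₁ refl) (inj₁ refl) (inj₁ refl) (inj₁ refl) _ _ _ _ (s≤s (s≤s ()))
valley-within-2 (inj₁ refl) (inj₁ refl) (inj₁ refl) (inj₂ refl) _ _ p₃ _ _ = ⊥-elim (p₃ refl refl)
valley-within-2 (inj₁ refl) (inj₁ refl) (inj₂ refl) _ _ p₂ _ _ _ = ⊥-elim (p₂ refl refl)
valley-within-2 (inj₁ refl) (inj₂ refl) _ _ p₁ _ _ _ _ = ⊥-elim (p₁ refl refl)
valley-within-2 (inj₂ refl) (inj₁ refl) (inj₁ refl) (inj₁ refl) _ _ _ _ (s≤s (s≤s ()))
valley-within-2 (inj₂ refl) (inj₁ refl) (inj₁ refl) (inj₂ refl) _ _ p₃ _ _ = ⊥-elim (p₃ refl refl)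
valley-within-2 (inj₂ refl) (inj₁ refl) (inj₂ refl) _ _ p₂ _ _ _ = ⊥-elim (p₂ refl refl)
valley-within-2 {g₂ = zero} (inj₂ refl) (inj₂ refl) (inj₁ refl) (inj₁ refl) _ _ _ _ _ = refl
valley-within-2 {g₂ = suc _} (inj₂ refl) (inj₂ refl) (inj₁ refl) (inj₁ refl) _ _ _ (s≤s (s≤s ())) _
valley-within-2 (inj₂ refl) (inj₂ refl) (inj₁ refl) (inj₂ refl) _ _ p₃ _ _ = ⊥-elim (p₃ refl refl)
valley-within-2 (inj₂ refl) (inj₂ refl) (inj₂ refl) _ _ _ _ (s≤s (s≤s ())) _

≤2∧≰1⇒≡2 : ∀ {x} → x ≤ 2 → ¬ (x ≤ 1) → x ≡ 2
≤2∧≰1⇒≡2 {zero} _ x≰1 = ⊥-elim (x≰1 z≤n)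
≤2∧≰1⇒≡2 {suc zero} _ x≰1 = ⊥-elim (x≰1 (s≤s z≤n))
≤2∧≰1⇒≡2 {suc (suc zero)} _ _ = refl
≤2∧≰1⇒≡2 {suc (suc (suc x))} (s≤s (s≤s ())) _

module TreeGeometry {m : ℕ} (Tr : Tree m) where
  open Walks (graph Tr)
  private
    GT : Graph m
    GT = graph Tr

  simple-is-geodesic : ∀ {P Q u v k j} (p : Walk GT Q u v k) → Simple p → (q : Walk GT P u v j) →
                       k ≤ j × (∀ y → y ∈w p → y ∈w q)
  simple-is-geodesic (here _) _ q = z≤n , λ { y refl → start∈ q }
  simple-is-geodesic {u = u} (step {w = w} _ a rest) (u∉ , rest-simple) q with w ∈w? q
  ... | yes w∈q with suffix q w∈q
  ...   | j' , j'≤j , full⇒start , q' , _ , q'⊆q with simple-is-geodesic rest rest-simple q'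
  ...     | k≤j' , rest⊆q' =
    ≤-trans (s≤s k≤j') (≤∧≢⇒< j'≤j (λ e → Graph.irrefl GT (subst (Adj GT u) (full⇒start e) a))) ,
    λ { y (inj₁ refl) → start∈ q ; y (inj₂ h) → q'⊆q y (rest⊆q' y h) }
  simple-is-geodesic (step _ a (here _)) _ q | no w∉q = ⊥-elim (w∉q (end∈ q))
  simple-is-geodesic (step _ a (step _ a₂ rest₂)) (u∉ , (w∉rest₂ , _)) q | no w∉q =
    ⊥-elim (no-bypass (acyclic Tr) a a₂ (λ e → u∉ (inj₂ (subst (_∈w rest₂) (sym e) (start∈ rest₂))))
       (avoiding q w∉q ++w reverse (avoiding rest₂ w∉rest₂)))
    where
    avoiding : ∀ {P u v k x} (q : Walk GT P u v k) → ¬ (x ∈w q) → Walk GT (λ w → w ≢ x) u v k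
    avoiding q x∉q = restrict q (λ y h e → x∉q (subst (_∈w q) e h))

  -- The tree distance, realised by a simple (hence geodesic) walk.
  dist : Fin m → Fin m → ℕ
  dist u v = proj₁ (shortcut (proj₂ (connected Tr u v)))

  geodesic : ∀ u v → Walk GT All u v (dist u v)
  geodesic u v = proj₁ (proj₂ (proj₂ (shortcut (proj₂ (connected Tr u v)))))

  geodesic-simple : ∀ u v → Simple (geodesic u v)
  geodesic-simple u v = proj₂ (proj₂ (proj₂ (shortcut (proj₂ (connected Tr u v)))))

  dist-≤-walk : ∀ {P u v k} → Walk GT P u v k → dist u v ≤ k
  dist-≤-walk {u = u} {v} q = proj₁ (simple-is-geodesic (geodesic u v) (geodesic-simple u v) q)

  simple-≤-dist : ∀ {P u v k} (p : Walk GT P u v k) → Simple p → k ≤ dist u v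
  simple-≤-dist {u = u} {v} p s = proj₁ (simple-is-geodesic p s (geodesic u v))

  distLe⇒≤ : ∀ {P u v k} → DistLe GT P u v k → dist u v ≤ k
  distLe⇒≤ (j , j≤k , q) = ≤-trans (dist-≤-walk q) j≤k

  convex-distLe : ∀ {u v k} (S : Subset m) → ConnectedIn Tr S → u ∈ S → v ∈ S →
                  dist u v ≤ k → DistLe GT (InS S) u v k
  convex-distLe {u} {v} S S-connected u∈S v∈S d≤k with S-connected u v u∈S v∈S
  ... | _ , q = dist u v , d≤k ,
    restrict (geodesic u v) (λ y h → ∈w⇒P q (proj₂ (simple-is-geodesic (geodesic u v) (geodesic-simple u v) q) y h))

  ≤⇒distLe : ∀ {u v k} → dist u v ≤ k → DistLe GT All u v k
  ≤⇒distLe {u} {v} d≤k = dist u v , d≤k , geodesic u v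

  dist-sym : ∀ u v → dist u v ≡ dist v u
  dist-sym u v = ≤-antisym (dist-≤-walk (reverse (geodesic v u))) (dist-≤-walk (reverse (geodesic u v)))

  ≤-dist-sym : ∀ {u v k} → dist u v ≤ k → dist v u ≤ k
  ≤-dist-sym {u} {v} = subst (_≤ _) (dist-sym u v)

  triangle : ∀ {u v w i j} → dist u v ≤ i → dist v w ≤ j → dist u w ≤ i + j
  triangle {u} {v} {w} h₁ h₂ = ≤-trans (dist-≤-walk (geodesic u v ++w geodesic v w)) (+-mono-≤ h₁ h₂)

  dist-refl : ∀ u → dist u u ≡ 0
  dist-refl u = ≤-antisym (dist-≤-walk (here {G = GT} {P = All} tt)) z≤n

  dist-zero : ∀ {u v} → dist u v ≡ 0 → u ≡ v
  dist-zero {u} {v} e = length-zero (subst (Walk GT All u v) e (geodesic u v))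

  dist-positive : ∀ {u v k} → 0 < k → dist u v ≡ k → u ≢ v
  dist-positive {u} 0<k e refl = <-irrefl (sym (trans (sym e) (dist-refl u))) 0<k

  dist-adjacent : ∀ {u v} → Adj GT u v → dist u v ≤ 1
  dist-adjacent a = dist-≤-walk (step {G = GT} {P = All} tt a (here tt))

  two-step : ∀ {u v} → dist u v ≡ 2 → ∃ λ c → Adj GT u c × Adj GT c v
  two-step {u} {v} e with subst (Walk GT All u v) e (geodesic u v)
  ... | step _ a₁ (step _ a₂ (here _)) = _ , a₁ , a₂

  -- Balls of a tree are connected: geodesics to the centre stay inside.
  ball : Fin m → ℕ → Subset m
  ball c r = subsetOf (λ w → dist w c ≤? r)

  ∈-ball⁺ : ∀ {c r w} → dist w c ≤ r → w ∈ ball c r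
  ∈-ball⁺ {c} {r} = ∈-subsetOf⁺ (λ w → dist w c ≤? r)

  ∈-ball⁻ : ∀ {c r w} → w ∈ ball c r → dist w c ≤ r
  ∈-ball⁻ {c} {r} = ∈-subsetOf⁻ (λ w → dist w c ≤? r)

  ball-connected : ∀ c r → ConnectedIn Tr (ball c r)
  ball-connected c r u v u∈ v∈ =
    _ , (inside (geodesic u c) (∈-ball⁻ u∈) ++w reverse (inside (geodesic v c) (∈-ball⁻ v∈)))
    where
    inside : ∀ {u} (p : Walk GT All u c (dist u c)) → dist u c ≤ r → Walk GT (InS (ball c r)) u c (dist u c)
    inside p d≤r = restrict p λ y y∈p → case suffix p y∈p of λ where
      (_ , j'≤ , _ , r' , _) → ∈-ball⁺ (≤-trans (dist-≤-walk r') (≤-trans j'≤ d≤r))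

  one-further : ∀ {a b} w → Adj GT a b → dist a w ≤ dist b w → dist b w ≡ suc (dist a w)
  one-further {a} {b} w ab le with b ∈w? geodesic a w
  ... | yes b∈ with suffix (geodesic a w) b∈
  ...   | j' , j'≤ , full⇒start , r , _ =
    ⊥-elim (Graph.irrefl GT (subst (Adj GT a) (full⇒start (≤-antisym j'≤ (≤-trans le (dist-≤-walk r)))) ab))
  one-further {a} {b} w ab le | no b∉ =
    ≤-antisym (triangle (dist-adjacent (Graph.sym GT ab)) ≤-refl)
              (simple-≤-dist (step tt (Graph.sym GT ab) (geodesic a w)) (b∉ , geodesic-simple a w))

  edge-step : ∀ {a b} w → Adj GT a b → OneApart (dist a w) (dist b w)
  edge-step {a} {b} w ab with ≤-total (dist a w) (dist b w)
  ... | inj₁ le = inj₁ (one-further w ab le)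
  ... | inj₂ le = inj₂ (one-further w (Graph.sym GT ab) le)

  -- The distance to w has no strict local maximum along a path x – y – z
  -- with x ≠ z: otherwise z, y, followed by the geodesic from x, would be
  -- a simple walk to w longer than dist z w.
  no-peak : ∀ {x y z} w → Adj GT x y → Adj GT y z → x ≢ z → NoPeak (dist x w) (dist y w) (dist z w)
  no-peak {x} {y} {z} w xy yz x≢z y≡1+x y≡1+z with y ∈w? geodesic x w
  ... | yes y∈ with suffix (geodesic x w) y∈
  ...   | j' , j'≤ , _ , r , _ =
    <-irrefl refl (≤-trans (s≤s j'≤) (≤-trans (≤-reflexive (sym y≡1+x)) (dist-≤-walk r)))
  no-peak {x} {y} {z} w xy yz x≢z y≡1+x y≡1+z | no y∉ with z ∈w? geodesic x w | z ≟ y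
  ... | _ | yes refl = Graph.irrefl GT yz
  ... | yes z∈ | no _ with suffix (geodesic x w) z∈
  ...   | j' , j'≤ , full⇒start , r , _ = x≢z (sym (full⇒start (≤-antisym j'≤ x≤j')))
    where
    x≤j' : dist x w ≤ j'
    x≤j' = ≤-trans (≤-reflexive (suc-injective (trans (sym y≡1+x) y≡1+z))) (dist-≤-walk r)
  no-peak {x} {y} {z} w xy yz x≢z y≡1+x y≡1+z | no y∉ | no z∉ | no z≢y =
    <-irrefl refl (≤-trans (s≤s (n≤1+n _))
      (≤-trans (simple-≤-dist detour detour-simple) (≤-reflexive (suc-injective (trans (sym y≡1+z) y≡1+x)))))
    where
    detour : Walk GT All z w (suc (suc (dist x w)))
    detour = step tt (Graph.sym GT yz) (step tt (Graph.sym GT xy) (geodesic x w))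
    detour-simple : Simple detour
    detour-simple = (λ { (inj₁ e) → z≢y e ; (inj₂ h) → z∉ h }) , y∉ , geodesic-simple x w

  record Path3 : Set where
    field
      a₀ a b b₀ : Fin m
      a₀a : Adj GT a₀ a
      ab  : Adj GT a b
      bb₀ : Adj GT b b₀
      length-3 : dist a₀ b₀ ≡ 3

  reverse3 : Path3 → Path3
  reverse3 p = record
    { a₀ = b₀ ; a = b ; b = a ; b₀ = a₀
    ; a₀a = Graph.sym GT bb₀ ; ab = Graph.sym GT ab ; bb₀ = Graph.sym GT a₀a
    ; length-3 = trans (dist-sym b₀ a₀) length-3 }
    where open Path3 p

  module ThreePath (p : Path3) where
    open Path3 p

    a₀≢b : a₀ ≢ b
    a₀≢b refl = <-irrefl refl (≤-trans (≤-reflexive (sym length-3)) (≤-trans (dist-adjacent bb₀) (s≤s z≤n)))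

    a≢b₀ : a ≢ b₀
    a≢b₀ refl = <-irrefl refl (≤-trans (≤-reflexive (sym length-3)) (≤-trans (dist-adjacent a₀a) (s≤s z≤n)))

    dist-a-b₀ : dist a b₀ ≡ 2
    dist-a-b₀ = ≤-antisym (triangle (dist-adjacent ab) (dist-adjacent bb₀))
      (≤-pred (≤-trans (≤-reflexive (sym length-3)) (triangle (dist-adjacent a₀a) ≤-refl)))

    profile-steps : ∀ w → OneApart (dist a₀ w) (dist a w) × OneApart (dist a w) (dist b w)
                        × OneApart (dist b w) (dist b₀ w)
    profile-steps w = edge-step w a₀a , edge-step w ab , edge-step w bb₀

    profile-no-peaks : ∀ w → NoPeak (dist a₀ w) (dist a w) (dist b w) × NoPeak (dist a w) (dist b w) (dist b₀ w)
    profile-no-peaks w = no-peak w a₀a ab a₀≢b , no-peak w ab bb₀ a≢b₀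

    Near4 : Fin m → Set
    Near4 w = dist a₀ w ≤ 4 × dist b₀ w ≤ 4

    near-middle : ∀ {w} → Near4 w → dist a w ≤ 2 ⊎ dist b w ≤ 2
    near-middle {w} (h₀ , h₃) with profile-steps w | profile-no-peaks w
    ... | s₁ , s₂ , s₃ | p₁ , p₂ = valley-within-4 s₁ s₂ s₃ p₁ p₂ h₀ h₃

    near-a : ∀ {w} → dist a₀ w ≤ 3 → dist b₀ w ≤ 3 → dist a w ≤ 2
    near-a {w} h₀ h₃ with profile-steps w | profile-no-peaks w
    ... | s₁ , s₂ , s₃ | p₁ , p₂ = valley-within-3 s₁ s₂ s₃ p₁ p₂ h₀ h₃

    -- Vertices near both ends lying beyond b (≥ 3 from a) and beyond a
    -- (≥ 3 from b) respectively are more than 4 apart: the path between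
    -- them runs through a and b.
    opposite-sides-far : ∀ {k₁ k₂} → Near4 k₁ → Near4 k₂ → 3 ≤ dist a k₁ → 3 ≤ dist b k₂ →
                         ¬ (dist k₂ k₁ ≤ 4)
    opposite-sides-far {k₁} {k₂} near₁ near₂ far₁ far₂ k₂k₁≤4 =
      <-irrefl refl (≤-trans (s≤s (s≤s far₁)) (≤-trans (≤-reflexive (sym k₂-beyond)) k₂k₁≤4))
      where
      b-between : dist a k₁ ≡ suc (dist b k₁)
      b-between with edge-step k₁ ab
      ... | inj₂ e = e
      ... | inj₁ e with near-middle near₁
      ...   | inj₁ h = ⊥-elim (<-irrefl refl (≤-trans far₁ h))
      ...   | inj₂ h = ⊥-elim (<⇒≱ (s≤s (s≤s (s≤s z≤n)))
                                    (≤-trans (≤-trans (s≤s far₁) (≤-reflexive (sym e))) h))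
      a-k₂ : dist a k₂ ≡ 2
      a-k₂ with near-middle near₂
      ... | inj₂ h = ⊥-elim (<-irrefl refl (≤-trans far₂ h))
      ... | inj₁ h = ≤2∧≰1⇒≡2 h λ h' →
        <-irrefl refl (≤-trans far₂ (triangle (≤-dist-sym (dist-adjacent ab)) h'))
      via : ∃ λ q → Adj GT k₂ q × Adj GT q a
      via = two-step (trans (dist-sym k₂ a) a-k₂)
      q : Fin m
      q = proj₁ via
      k₂q : Adj GT k₂ q
      k₂q = proj₁ (proj₂ via)
      qa : Adj GT q a
      qa = proj₂ (proj₂ via)
      q≢b : q ≢ b
      q≢b q≡b = <⇒≱ (s≤s (s≤s z≤n))
        (≤-trans far₂ (subst (λ z → dist z k₂ ≤ 1) q≡b (≤-dist-sym (dist-adjacent k₂q))))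
      k₂≢a : k₂ ≢ a
      k₂≢a = dist-positive (s≤s z≤n) (trans (dist-sym k₂ a) a-k₂)
      q-beyond : dist q k₁ ≡ suc (dist a k₁)
      q-beyond = rises-before-descent (edge-step k₁ qa) b-between (no-peak k₁ qa ab q≢b)
      k₂-beyond : dist k₂ k₁ ≡ suc (suc (dist a k₁))
      k₂-beyond = trans (rises-before-descent (edge-step k₁ k₂q) q-beyond (no-peak k₁ k₂q qa k₂≢a))
                        (cong suc q-beyond)

  Within : Subset m → Path3 → Set
  Within S p = a₀ ∈ S × a ∈ S × b ∈ S × b₀ ∈ S
    where open Path3 p

  within-reverse : ∀ {S} p → Within S p → Within S (reverse3 p)
  within-reverse p (a₀∈ , a∈ , b∈ , b₀∈) = b₀∈ , b∈ , a∈ , a₀∈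

  bistar-path : ∀ {S} → ConnectedIn Tr S → IsBistar Tr S → Σ Path3 (Within S)
  bistar-path {S} S-connected (diameter≤3 , a₀ , b₀ , a₀∈ , b₀∈ , far) = split walk-in-S
    where
    length-3 : dist a₀ b₀ ≡ 3
    length-3 = ≤-antisym (distLe⇒≤ (diameter≤3 a₀ b₀ a₀∈ b₀∈))
                         (≰⇒> (λ h → far (convex-distLe S S-connected a₀∈ b₀∈ h)))
    walk-in-S : Walk GT (InS S) a₀ b₀ 3
    walk-in-S with convex-distLe S S-connected a₀∈ b₀∈ (≤-reflexive length-3)
    ... | j , j≤3 , q = subst (Walk GT (InS S) a₀ b₀)
                              (≤-antisym j≤3 (≤-trans (≤-reflexive (sym length-3)) (dist-≤-walk q))) q
    split : Walk GT (InS S) a₀ b₀ 3 → Σ Path3 (Within S)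
    split (step _ a₀a (step a∈ ab (step b∈ bb₀ (here _)))) =
      record { a₀a = a₀a ; ab = ab ; bb₀ = bb₀ ; length-3 = length-3 } , a₀∈ , a∈ , b∈ , b₀∈

  module DiametralPath {S : Subset m} (S-connected : ConnectedIn Tr S) (bistar : IsBistar Tr S)
                       (p : Path3) (p∈S : Within S p) where
    open Path3 p
    open ThreePath p

    private
      a₀∈ : a₀ ∈ S
      a₀∈ = proj₁ p∈S
      a∈ : a ∈ S
      a∈ = proj₁ (proj₂ p∈S)
      b₀∈ : b₀ ∈ S
      b₀∈ = proj₂ (proj₂ (proj₂ p∈S))

      diameter≤3 : ∀ {u v} → u ∈ S → v ∈ S → dist u v ≤ 3
      diameter≤3 u∈ v∈ = distLe⇒≤ (proj₁ bistar _ _ u∈ v∈)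

    end-is-leaf : ∀ v → v ∈ S → Adj GT a₀ v → v ≡ a
    end-is-leaf v v∈ a₀v with v ≟ a
    ... | yes v≡a = v≡a
    ... | no v≢a with edge-step b₀ a₀v
    ...   | inj₁ e = ⊥-elim (<-irrefl refl
              (≤-trans (≤-reflexive (trans (cong suc (sym length-3)) (sym e))) (diameter≤3 v∈ b₀∈)))
    ...   | inj₂ e = ⊥-elim (no-peak b₀ (Graph.sym GT a₀v) a₀a v≢a e (trans length-3 (sym (cong suc dist-a-b₀))))

    a-central : InCenter Tr S a
    a-central = a∈ , λ u u∈ e ecc w w∈ → a-ecc u u∈ e ecc w w∈
      where
      -- Any eccentricity bound e ≥ 2 holds at a; no vertex has eccentricity ≤ 1,
      -- since a₀ and b₀ are 3 apart.
      a-ecc : ∀ u → u ∈ S → ∀ e → EccLe Tr S u e → EccLe Tr S a e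
      a-ecc u u∈ e ecc w w∈ with 2 ≤? e
      ... | yes 2≤e = convex-distLe S S-connected a∈ w∈
                        (≤-trans (near-a (diameter≤3 a₀∈ w∈) (diameter≤3 b₀∈ w∈)) 2≤e)
      ... | no 2≰e = ⊥-elim (<-irrefl refl (≤-trans (≤-reflexive (sym length-3))
                      (triangle (≤-dist-sym (≤-trans (distLe⇒≤ (ecc a₀ a₀∈)) e≤1))
                                (≤-trans (distLe⇒≤ (ecc b₀ b₀∈)) e≤1))))
        where
        e≤1 : e ≤ 1
        e≤1 = ≤-pred (≰⇒> 2≰e)

-- Every leaf ℓ of a spanning subtree T⟨X⟩ is the image of a vertex of X:
-- otherwise T⟨X⟩ without ℓ would be a smaller subtree containing ι[X].
leaf-is-terminal : ∀ {n} {G : Graph n} (R : SteinerRoot4 G) {X S} → IsSpanningSubtree R X S →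
                   ∀ {ℓ c} → ℓ ∈ S → Adj (graph (T R)) ℓ c →
                   (∀ v → v ∈ S → Adj (graph (T R)) ℓ v → v ≡ c) →
                   ∃ λ x → x ∈ X × ι R x ≡ ℓ
leaf-is-terminal R {X} {S} (S-connected , X⊆S , S-minimal) {ℓ} {c} ℓ∈S ℓc leaf
  with any? (λ x → (x ∈? X) ×-dec (ι R x ≟ ℓ))
... | yes found = found
... | no none = ⊥-elim (proj₂ (∈-subsetOf⁻ without-ℓ? (S-minimal S' S'-connected X⊆S' ℓ∈S)) refl)
  where
  open Walks (graph (T R))
  GT : Graph (m R)
  GT = graph (T R)
  without-ℓ? : ∀ w → Dec (w ∈ S × w ≢ ℓ)
  without-ℓ? w = (w ∈? S) ×-dec ¬? (w ≟ ℓ)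
  S' : Subset (m R)
  S' = subsetOf without-ℓ?
  -- A walk in S between vertices other than ℓ that enters ℓ must come
  -- from c and return to c, so the visit can be cut out.
  avoid-leaf : ∀ {u v k} → Walk GT (InS S) u v k → u ≢ ℓ → v ≢ ℓ → ∃ λ j → Walk GT (InS S') u v j
  avoid-leaf (here p) u≢ℓ _ = 0 , here (∈-subsetOf⁺ without-ℓ? (p , u≢ℓ))
  avoid-leaf (step {w = w} p uw r) u≢ℓ v≢ℓ with w ≟ ℓ
  avoid-leaf (step {w = w} p uw r) u≢ℓ v≢ℓ | no w≢ℓ with avoid-leaf r w≢ℓ v≢ℓ
  ... | j , r' = suc j , step (∈-subsetOf⁺ without-ℓ? (p , u≢ℓ)) uw r'
  avoid-leaf (step p uw (here _)) u≢ℓ v≢ℓ | yes refl = ⊥-elim (v≢ℓ refl)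
  avoid-leaf {u} {v} (step p uℓ (step {w = w'} _ ℓw' r)) u≢ℓ v≢ℓ | yes refl
    with avoid-leaf r w'≢ℓ v≢ℓ
    where
    w'≡c : w' ≡ c
    w'≡c = leaf w' (startP r) ℓw'
    w'≢ℓ : w' ≢ ℓ
    w'≢ℓ e = Graph.irrefl GT (subst (λ z → Adj GT z c) (trans (sym e) w'≡c) ℓc)
  ... | j , r' = j , subst (λ z → Walk GT (InS S') z v j)
                           (trans (leaf w' (startP r) ℓw') (sym (leaf u p (Graph.sym GT uℓ)))) r'
  S'-connected : ConnectedIn (T R) S'
  S'-connected u v u∈ v∈ with ∈-subsetOf⁻ without-ℓ? u∈ | ∈-subsetOf⁻ without-ℓ? v∈
  ... | u∈S , u≢ℓ | v∈S , v≢ℓ = avoid-leaf (proj₂ (S-connected u v u∈S v∈S)) u≢ℓ v≢ℓ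
  X⊆S' : ∀ x → x ∈ X → ι R x ∈ S'
  X⊆S' x x∈X = ∈-subsetOf⁺ without-ℓ? (X⊆S x x∈X , λ e → none (x , x∈X , e))

module RootCliques {n : ℕ} {G : Graph n} (R : SteinerRoot4 G) where
  open TreeGeometry (T R)

  clique⇒close : ∀ {K} → IsClique G K → ∀ {u v} → u ∈ K → v ∈ K → dist (ι R u) (ι R v) ≤ 4
  clique⇒close K-clique {u} {v} u∈ v∈ with u ≟ v
  ... | yes refl = subst (_≤ 4) (sym (dist-refl _)) z≤n
  ... | no u≢v = distLe⇒≤ (Equivalence.to (root R u v u≢v) (K-clique u v u∈ v∈ u≢v))

  close⇒adjacent : ∀ {u v} → u ≢ v → dist (ι R u) (ι R v) ≤ 4 → Adj G u v
  close⇒adjacent {u} {v} u≢v d≤4 = Equivalence.from (root R u v u≢v) (≤⇒distLe d≤4)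

  absorbs : ∀ {K} → IsMaximalClique G K → ∀ u → (∀ v → v ∈ K → dist (ι R v) (ι R u) ≤ 4) → u ∈ K
  absorbs {K} (K-clique , K-maximal) u close =
    K-maximal K+u K+u-clique (∈-subsetOf⁺ K+u? ∘ inj₁) (∈-subsetOf⁺ K+u? (inj₂ refl))
    where
    K+u? : ∀ v → Dec (v ∈ K ⊎ v ≡ u)
    K+u? v = (v ∈? K) ⊎-dec (v ≟ u)
    K+u : Subset n
    K+u = subsetOf K+u?
    K+u-clique : IsClique G K+u
    K+u-clique v w v∈ w∈ v≢w with ∈-subsetOf⁻ K+u? v∈ | ∈-subsetOf⁻ K+u? w∈
    ... | inj₁ v∈K | inj₁ w∈K = K-clique v w v∈K w∈K v≢w
    ... | inj₁ v∈K | inj₂ refl = close⇒adjacent v≢w (close v v∈K)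
    ... | inj₂ refl | inj₁ w∈K = close⇒adjacent v≢w (≤-dist-sym (close w w∈K))
    ... | inj₂ refl | inj₂ refl = ⊥-elim (v≢w refl)

  around : Fin (m R) → Subset n
  around c = subsetOf (λ v → dist (ι R v) c ≤? 2)

  -- They form a clique, so a maximal clique inside it is all of it.
  maximal-within-around : ∀ {K} c → IsMaximalClique G K → (∀ k → k ∈ K → dist (ι R k) c ≤ 2) → K ≡ around c
  maximal-within-around {K} c (K-clique , K-maximal) K-near = ⊆-antisym K⊆ (K-maximal (around c) around-clique K⊆)
    where
    around? : ∀ v → Dec (dist (ι R v) c ≤ 2)
    around? v = dist (ι R v) c ≤? 2
    K⊆ : K ⊆ around c
    K⊆ {k} k∈ = ∈-subsetOf⁺ around? (K-near k k∈)
    around-clique : IsClique G (around c)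
    around-clique u v u∈ v∈ u≢v =
      close⇒adjacent u≢v (triangle (∈-subsetOf⁻ around? u∈) (≤-dist-sym (∈-subsetOf⁻ around? v∈)))

  Terminal : Subset n → Fin (m R) → Set
  Terminal X w = ∃ λ x → x ∈ X × ι R x ≡ w

  module AroundPath {X : Subset n} (p : Path3) (a₀-terminal : Terminal X (Path3.a₀ p))
                    (b₀-terminal : Terminal X (Path3.b₀ p)) where
    open Path3 p
    open ThreePath p

    clique-near : ∀ {K} → IsClique G K → X ⊆ K → ∀ {k} → k ∈ K → Near4 (ι R k)
    clique-near K-clique X⊆K {k} k∈ = from-terminal a₀-terminal , from-terminal b₀-terminal
      where
      from-terminal : ∀ {w} → Terminal X w → dist w (ι R k) ≤ 4
      from-terminal (x , x∈X , refl) = clique⇒close K-clique (X⊆K x∈X) k∈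

    one-sided : ∀ {K} → IsClique G K → X ⊆ K → ∀ {z} → z ∈ K → 3 ≤ dist b (ι R z) →
                ∀ k → k ∈ K → dist (ι R k) a ≤ 2
    one-sided K-clique X⊆K {z} z∈ z-far k k∈ with dist (ι R k) a ≤? 2
    ... | yes k-near = k-near
    ... | no k-far = ⊥-elim (opposite-sides-far (clique-near K-clique X⊆K k∈) (clique-near K-clique X⊆K z∈)
                              (subst (3 ≤_) (dist-sym (ι R k) a) (≰⇒> k-far)) z-far (clique⇒close K-clique z∈ k∈))

    -- A clique intersection X with terminals at a₀ and b₀ contains every
    -- vertex within 2 of both a and b: such a vertex is absorbed by every
    -- maximal clique containing X.
    core⊆X : IsCliqueIntersection G X → ∀ u → dist a (ι R u) ≤ 2 → dist b (ι R u) ≤ 2 → u ∈ X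
    core⊆X (_ , _ , Ks , Ks-maximal , X-iff) u a-u b-u =
      Equivalence.from (X-iff u) λ j → absorbs (Ks-maximal j) u (close j)
      where
      close : ∀ j v → v ∈ Ks j → dist (ι R v) (ι R u) ≤ 4
      close j v v∈ with near-middle (clique-near (proj₁ (Ks-maximal j)) (λ x∈ → Equivalence.to (X-iff _) x∈ j) v∈)
      ... | inj₁ a-v = triangle (≤-dist-sym a-v) a-u
      ... | inj₂ b-v = triangle (≤-dist-sym b-v) b-u

  -- If K lies within
  -- 2 of a but has a member at distance ≥ 3 from b, then a is the unique
  -- centre of SK: SK lies in the ball of radius 2 about a, and any centre v
  -- sees the path b₀, b, a, y, ι ks within distance 2, forcing v = a.
  module CentreShrinks {K : Subset n} {SK SX : Subset (m R)} (SK-span : IsSpanningSubtree R K SK) (SX⊆SK : SX ⊆ SK)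
                       (p : Path3) (p∈SX : Within SX p) where
    open Path3 p
    open ThreePath p

    private
      GT : Graph (m R)
      GT = graph (T R)
      SK-connected : ConnectedIn (T R) SK
      SK-connected = proj₁ SK-span
      a∈SK : a ∈ SK
      a∈SK = SX⊆SK (proj₁ (proj₂ p∈SX))
      b₀∈SK : b₀ ∈ SK
      b₀∈SK = SX⊆SK (proj₂ (proj₂ (proj₂ p∈SX)))

    centre-shrinks : InCenter (T R) SX a → InCenter (T R) SX b →
                     (∀ k → k ∈ K → dist (ι R k) a ≤ 2) → ∀ {ks} → ks ∈ K → 3 ≤ dist b (ι R ks) →
                     (∀ v → InCenter (T R) SK v → InCenter (T R) SX v)
                     × (∃ λ v → InCenter (T R) SX v × ¬ InCenter (T R) SK v)
    centre-shrinks a-central b-central K-near {ks} ks∈ ks-far =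
      (λ v v-central → subst (InCenter (T R) SX) (only-centre v v-central) a-central) ,
      (b , b-central , λ b-central-SK →
         <-irrefl refl (≤-trans ks-far (distLe⇒≤ (proj₂ b-central-SK a a∈SK 2 a-ecc k* k*∈SK))))
      where
      SK⊆ball : SK ⊆ ball a 2
      SK⊆ball = proj₂ (proj₂ SK-span) (ball a 2) (ball-connected a 2) (λ k k∈ → ∈-ball⁺ (K-near k k∈))
      a-ecc : EccLe (T R) SK a 2
      a-ecc w w∈ = convex-distLe SK SK-connected a∈SK w∈ (≤-dist-sym (∈-ball⁻ (SK⊆ball w∈)))
      k* : Fin (m R)
      k* = ι R ks
      k*∈SK : k* ∈ SK
      k*∈SK = proj₁ (proj₂ SK-span) ks ks∈
      a-k* : dist a k* ≡ 2
      a-k* = ≤2∧≰1⇒≡2 (≤-dist-sym (K-near ks ks∈))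
                        (λ h → <-irrefl refl (≤-trans ks-far (triangle (≤-dist-sym (dist-adjacent ab)) h)))
      via : ∃ λ y → Adj GT a y × Adj GT y k*
      via = two-step a-k*
      y : Fin (m R)
      y = proj₁ via
      ay : Adj GT a y
      ay = proj₁ (proj₂ via)
      yk* : Adj GT y k*
      yk* = proj₂ (proj₂ via)
      b≢y : b ≢ y
      b≢y b≡y = <⇒≱ (s≤s (s≤s z≤n))
                    (≤-trans ks-far (subst (λ z → dist z k* ≤ 1) (sym b≡y) (dist-adjacent yk*)))
      a≢k* : a ≢ k*
      a≢k* = dist-positive (s≤s z≤n) a-k*
      only-centre : ∀ v → InCenter (T R) SK v → a ≡ v
      only-centre v (_ , v-minimal) = dist-zero (valley-within-2
          (edge-step v (Graph.sym GT bb₀)) (edge-step v (Graph.sym GT ab)) (edge-step v ay) (edge-step v yk*)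
          (no-peak v (Graph.sym GT bb₀) (Graph.sym GT ab) (λ e → a≢b₀ (sym e)))
          (no-peak v (Graph.sym GT ab) ay b≢y) (no-peak v ay yk* a≢k*)
          (≤-dist-sym (distLe⇒≤ (v-ecc b₀ b₀∈SK))) (≤-dist-sym (distLe⇒≤ (v-ecc k* k*∈SK))))
        where
        v-ecc : EccLe (T R) SK v 2
        v-ecc = v-minimal a a∈SK 2 a-ecc

two-values : ∀ {S : Set} {A B x y z : S} → x ≡ A ⊎ x ≡ B → y ≡ A ⊎ y ≡ B → z ≡ A ⊎ z ≡ B →
             y ≢ z → x ≡ y ⊎ x ≡ z
two-values (inj₁ refl) (inj₁ refl) _ _ = inj₁ refl
two-values (inj₁ refl) (inj₂ refl) (inj₁ refl) _ = inj₂ refl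
two-values (inj₁ refl) (inj₂ refl) (inj₂ refl) y≢z = ⊥-elim (y≢z refl)
two-values (inj₂ refl) (inj₂ refl) _ _ = inj₁ refl
two-values (inj₂ refl) (inj₁ refl) (inj₂ refl) _ = inj₂ refl
two-values (inj₂ refl) (inj₁ refl) (inj₁ refl) y≢z = ⊥-elim (y≢z refl)

missing-member : ∀ {n} {G : Graph n} {X} → IsCliqueIntersection G X → ∀ {z} → z ∉ X →
                 ∃ λ K → IsMaximalClique G K × X ⊆ K × z ∉ K
missing-member (_ , _ , Ks , Ks-maximal , X-iff) {z} z∉X with all? (λ j → z ∈? Ks j)
... | yes z∈all = ⊥-elim (z∉X (Equivalence.from (X-iff z) z∈all))
... | no z∉some with ¬∀⟶∃¬ _ (λ j → z ∈ Ks j) (λ j → z ∈? Ks j) z∉some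
...   | j , z∉Kj = Ks j , Ks-maximal j , (λ x∈ → Equivalence.to (X-iff _) x∈ j) , z∉Kj

module Lemma53 {n : ℕ} {G : Graph n} (R : SteinerRoot4 G) {Ki X : Subset n} {SK SX : Subset (m R)}
               (Ki-maximal : IsMaximalClique G Ki) (X-intersection : IsCliqueIntersection G X) (X⊂Ki : X ⊂ Ki)
               (SK-span : IsSpanningSubtree R Ki SK) (SX-span : IsSpanningSubtree R X SX)
               (bistar : IsBistar (T R) SX) where
  open TreeGeometry (T R)
  open RootCliques R

  X⊆Ki : X ⊆ Ki
  X⊆Ki = proj₁ X⊂Ki

  z₀ : Fin n
  z₀ = proj₁ (proj₂ X⊂Ki)

  z₀∈Ki : z₀ ∈ Ki
  z₀∈Ki = proj₁ (proj₂ (proj₂ X⊂Ki))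

  z₀∉X : z₀ ∉ X
  z₀∉X = proj₂ (proj₂ (proj₂ X⊂Ki))

  SX⊆SK : SX ⊆ SK
  SX⊆SK = proj₂ (proj₂ SX-span) SK (proj₁ SK-span) (λ x x∈ → proj₁ (proj₂ SK-span) x (X⊆Ki x∈))

  p : Path3
  p = proj₁ (bistar-path (proj₁ SX-span) bistar)

  p∈SX : Within SX p
  p∈SX = proj₂ (bistar-path (proj₁ SX-span) bistar)

  q : Path3
  q = reverse3 p

  q∈SX : Within SX q
  q∈SX = within-reverse p p∈SX

  open Path3 p

  -- The ends of a diametral path are leaves of SX = T⟨X⟩, hence terminals.
  start-terminal : ∀ r → Within SX r → Terminal X (Path3.a₀ r)
  start-terminal r r∈ = leaf-is-terminal R SX-span (proj₁ r∈) (Path3.a₀a r)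
                          (DiametralPath.end-is-leaf (proj₁ SX-span) bistar r r∈)

  middle-central : ∀ r → Within SX r → InCenter (T R) SX (Path3.a r)
  middle-central r r∈ = DiametralPath.a-central (proj₁ SX-span) bistar r r∈

  module P = AroundPath p (start-terminal p p∈SX) (start-terminal q q∈SX)
  module Q = AroundPath q (start-terminal q q∈SX) (start-terminal p p∈SX)

  outside-X : ∀ {K} → IsMaximalClique G K → X ⊆ K → ∃ λ z → z ∈ K × z ∉ X
  outside-X {K} (_ , K-maximal) X⊆K with any? (λ v → (v ∈? K) ×-dec ¬? (v ∈? X))
  ... | yes found = found
  ... | no none = ⊥-elim (z₀∉X (K⊆X (K-maximal Ki (proj₁ Ki-maximal) (X⊆Ki ∘ K⊆X) z₀∈Ki)))
    where
    K⊆X : K ⊆ X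
    K⊆X {v} v∈K with v ∈? X
    ... | yes v∈X = v∈X
    ... | no v∉X = ⊥-elim (none (v , v∈K , v∉X))

  OnSide : Path3 → Subset n → Set
  OnSide r K = (∀ k → k ∈ K → dist (ι R k) (Path3.a r) ≤ 2)
               × ∃ λ z → z ∈ K × 3 ≤ dist (Path3.b r) (ι R z)

  -- Every maximal clique K ⊇ X sits on the side of a or on the side of b:
  -- a member outside X is far from a or from b, and that decides the side.
  side : ∀ {K} → IsMaximalClique G K → X ⊆ K → OnSide p K ⊎ OnSide q K
  side K-maximal@(K-clique , _) X⊆K with outside-X K-maximal X⊆K
  ... | z , z∈ , z∉X with dist a (ι R z) ≤? 2 | dist b (ι R z) ≤? 2
  ...   | yes a-z | yes b-z = ⊥-elim (z∉X (P.core⊆X X-intersection z a-z b-z))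
  ...   | _ | no b-far = inj₁ (P.one-sided K-clique X⊆K z∈ (≰⇒> b-far) , z , z∈ , ≰⇒> b-far)
  ...   | no a-far | yes _ = inj₂ (Q.one-sided K-clique X⊆K z∈ (≰⇒> a-far) , z , z∈ , ≰⇒> a-far)

  two-candidates : ∀ K → IsMaximalClique G K → X ⊆ K → K ≡ around a ⊎ K ≡ around b
  two-candidates K K-maximal X⊆K with side K-maximal X⊆K
  ... | inj₁ (K-near , _) = inj₁ (maximal-within-around a K-maximal K-near)
  ... | inj₂ (K-near , _) = inj₂ (maximal-within-around b K-maximal K-near)

  -- A second maximal clique containing X: one that misses z₀ ∈ Ki.
  second-clique : ∃ λ K → IsMaximalClique G K × X ⊆ K × z₀ ∉ K
  second-clique = missing-member {G = G} X-intersection z₀∉X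

  K₂ : Subset n
  K₂ = proj₁ second-clique

  K₂-maximal : IsMaximalClique G K₂
  K₂-maximal = proj₁ (proj₂ second-clique)

  X⊆K₂ : X ⊆ K₂
  X⊆K₂ = proj₁ (proj₂ (proj₂ second-clique))

  Ki≢K₂ : Ki ≢ K₂
  Ki≢K₂ Ki≡K₂ = proj₂ (proj₂ (proj₂ second-clique)) (subst (z₀ ∈_) Ki≡K₂ z₀∈Ki)

  exactly-two : ∀ K → IsMaximalClique G K → X ⊆ K → K ≡ Ki ⊎ K ≡ K₂
  exactly-two K K-maximal X⊆K =
    two-values (two-candidates K K-maximal X⊆K) (two-candidates Ki Ki-maximal X⊆Ki)
               (two-candidates K₂ K₂-maximal X⊆K₂) Ki≢K₂

  centres : (∀ v → InCenter (T R) SK v → InCenter (T R) SX v)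
            × (∃ λ v → InCenter (T R) SX v × ¬ InCenter (T R) SK v)
  centres with side Ki-maximal X⊆Ki
  ... | inj₁ (Ki-near , _ , ks∈ , ks-far) =
    CentreShrinks.centre-shrinks SK-span SX⊆SK p p∈SX (middle-central p p∈SX) (middle-central q q∈SX) Ki-near ks∈ ks-far
  ... | inj₂ (Ki-near , _ , ks∈ , ks-far) =
    CentreShrinks.centre-shrinks SK-span SX⊆SK q q∈SX (middle-central q q∈SX) (middle-central p p∈SX) Ki-near ks∈ ks-far

lemma5p3 : {n : ℕ} (G : Graph n) (R : SteinerRoot4 G) (Ki X : Subset n)
    → IsMaximalClique G Ki
    → IsCliqueIntersection G X
    → X ⊂ Ki
    → (SK SX : Subset (m R))
    → IsSpanningSubtree R Ki SK
    → IsSpanningSubtree R X SX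
    → IsBistar (T R) SX
    → ((∀ v → InCenter (T R) SK v → InCenter (T R) SX v)
        × (∃ λ v → InCenter (T R) SX v × ¬ InCenter (T R) SK v))
      × (∃ λ K₁ → ∃ λ K₂ → K₁ ≢ K₂
          × IsMaximalClique G K₁ × X ⊆ K₁
          × IsMaximalClique G K₂ × X ⊆ K₂
          × (∀ K → IsMaximalClique G K → X ⊆ K → K ≡ K₁ ⊎ K ≡ K₂))
lemma5p3 G R Ki X Ki-maximal X-intersection X⊂Ki SK SX SK-span SX-span bistar =
  centres , Ki , K₂ , Ki≢K₂ , Ki-maximal , X⊆Ki , K₂-maximal , X⊆K₂ , exactly-two
  where open Lemma53 R Ki-maximal X-intersection X⊂Ki SK-span SX-span bistar
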